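{- Let $B$ be a complete Boolean algebra isomorphic to $\mathcal{RO}(S,\sqsubseteq)$ for some poset $(S,\sqsubseteq)$. Then for any Boolean algebra expansion $\mathbb{B}=(B,\{f_i\}_{i\in I})$ there is a basic neighborhood possibility frame $(S,\sqsubseteq,\{N_i\}_{i\in I})$ (on the same poset) whose algebra $(S,\sqsubseteq,\{N_i\}_{i\in I})^\mathsf{b}$ is isomorphic to $\mathbb{B}$.
   Context: A Boolean algebra expansion is $(B,\{f_i\}_{i\in I})$ with $B$ a Boolean algebra and $f_i:B\to B$ arbitrary functions; isomorphisms are Boolean isomorphisms commuting with the $f_i$. For a poset $(S,\sqsubseteq)$, $\mathcal{RO}(S,\sqsubseteq)$ is the complete Boolean algebra (under inclusion) of sets $U=\{x\mid\forall x'\sqsubseteq x\ \exists x''\sqsubseteq x':x''\in U\}$. A basic neighborhood possibility frame is $(S,\sqsubseteq,\{N_i\}_{i\in I})$ with $N_i:S\to\wp(\mathcal{RO}(S,\sqsubseteq))$ satisfying $N_i$-persistence ($x'\sqsubseteq x$ implies $N_i(x')\supseteq N_i(x)$) and $N_i$-refinability (if $U\notin N_i(x)$ then $\exists x'\sqsubseteq x\ \forall x''\sqsubseteq x'\ U\notin N_i(x'')$). Its algebra is $(\mathcal{RO}(S,\sqsubseteq),\{\Box_{N_i}\}_{i\in I})$ with $\Box_{N_i}U=\{x\mid U\in N_i(x)\}$. -}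

module Defs where

open import Level using (Level; _⊔_; suc; Lift; lift; lower)
open import Data.Product using (Σ; ∃; ∃-syntax; _×_; _,_; proj₁; proj₂)
open import Data.Sum using (_⊎_; inj₁; inj₂)
open import Data.Empty using (⊥)
open import Data.Unit using (⊤; tt)
open import Relation.Nullary using (¬_)
open import Relation.Binary.Bundles using (Poset)
open import Algebra.Lattice.Bundles using (BooleanAlgebra)

module BA {c ℓ} (B : BooleanAlgebra c ℓ) where
  open BooleanAlgebra B

  _≤B_ : Carrier → Carrier → Set ℓ
  x ≤B y = (x ∧ y) ≈ x

  IsLUB : ∀ {q} → (Carrier → Set q) → Carrier → Set (c ⊔ ℓ ⊔ q)
  IsLUB P s = (∀ x → P x → x ≤B s) × (∀ u → (∀ x → P x → x ≤B u) → s ≤B u)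

  IsComplete : Set (suc (c ⊔ ℓ))
  IsComplete = (P : Carrier → Set (c ⊔ ℓ)) → ∃[ s ] IsLUB P s

module RO {a e r} (S : Poset a e r) (p : Level) where
  open Poset S renaming (Carrier to Pt; _≤_ to _⊑_)

  L : Level
  L = a ⊔ r ⊔ p

  Subset : Set (suc L)
  Subset = Pt → Set L

  ic : Subset → Subset
  ic U x = ∀ x' → x' ⊑ x → ∃[ x'' ] (x'' ⊑ x' × U x'')

  IsRegular : Subset → Set L
  IsRegular U = ∀ x → (U x → ic U x) × (ic U x → U x)

  RO : Set (suc L)
  RO = Σ Subset IsRegular

  ⟦_⟧ : RO → Subset
  ⟦ U ⟧ = proj₁ U

  _≐_ : ∀ {q q'} → (Pt → Set q) → (Pt → Set q') → Set (a ⊔ q ⊔ q')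
  U ≐ V = ∀ x → (U x → V x) × (V x → U x)

  _≈RO_ : RO → RO → Set L
  U ≈RO V = ⟦ U ⟧ ≐ ⟦ V ⟧

  persist : (U : RO) → ∀ {x y} → y ⊑ x → ⟦ U ⟧ x → ⟦ U ⟧ y
  persist (U , reg) {x} {y} y⊑x u =
    proj₂ (reg y) (λ y' y'⊑y → proj₁ (reg x) u y' (trans y'⊑y y⊑x))

  _∧RO_ : RO → RO → RO
  U ∧RO V = W , reg
    where
    W : Subset
    W x = ⟦ U ⟧ x × ⟦ V ⟧ x
    reg : IsRegular W
    reg x = (λ (u , v) x' x'⊑x → x' , refl , persist U x'⊑x u , persist V x'⊑x v)
          , (λ h → proj₂ (proj₂ U x) (λ x' x'⊑x → let (z , z⊑ , w) = h x' x'⊑x in z , z⊑ , proj₁ w)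
                 , proj₂ (proj₂ V x) (λ x' x'⊑x → let (z , z⊑ , w) = h x' x'⊑x in z , z⊑ , proj₂ w))

  _∨RO_ : RO → RO → RO
  U ∨RO V = ic W , reg
    where
    W : Subset
    W x = ⟦ U ⟧ x ⊎ ⟦ V ⟧ x
    reg : IsRegular (ic W)
    reg x = (λ h x' x'⊑x → x' , refl , λ y y⊑x' → h y (trans y⊑x' x'⊑x))
          , (λ h x' x'⊑x → let (y , y⊑x' , g) = h x' x'⊑x
                               (z , z⊑y , w) = g y refl
                           in z , trans z⊑y y⊑x' , w)

  ¬RO_ : RO → RO
  ¬RO U = W , reg
    where
    W : Subset
    W x = ∀ x' → x' ⊑ x → ¬ ⟦ U ⟧ x'
    reg : IsRegular W
    reg x = (λ n x' x'⊑x → x' , refl , λ y y⊑x' → n y (trans y⊑x' x'⊑x))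
          , (λ h x' x'⊑x u → let (z , z⊑x' , n) = h x' x'⊑x
                             in n z refl (persist U z⊑x' u))

  ⊤RO : RO
  ⊤RO = (λ _ → Lift L ⊤) , λ x → (λ _ x' _ → x' , refl , lift tt) , λ _ → lift tt

  ⊥RO : RO
  ⊥RO = (λ _ → Lift L ⊥) , λ x → (λ ()) , λ h → proj₂ (proj₂ (h x refl))

module Iso {c ℓ a e r} (B : BooleanAlgebra c ℓ) (S : Poset a e r) (p : Level) where
  open BooleanAlgebra B renaming (¬_ to ¬B_; ⊤ to ⊤B; ⊥ to ⊥B)
  open RO S p

  IsBooleanIso : (Carrier → RO) → Set (c ⊔ ℓ ⊔ suc L)
  IsBooleanIso h =
      (∀ {x y} → x ≈ y → h x ≈RO h y)
    × (∀ {x y} → h x ≈RO h y → x ≈ y)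
    × (∀ U → ∃[ x ] (h x ≈RO U))
    × (∀ x y → h (x ∧ y) ≈RO (h x ∧RO h y))
    × (∀ x y → h (x ∨ y) ≈RO (h x ∨RO h y))
    × (∀ x → h (¬B x) ≈RO (¬RO h x))
    × (h ⊤B ≈RO ⊤RO)
    × (h ⊥B ≈RO ⊥RO)

module Frame {a e r} (S : Poset a e r) (p : Level) where
  open Poset S renaming (Carrier to Pt; _≤_ to _⊑_)
  open RO S p

  -- N i x is a set of regular open sets (a subset of RO(S, ⊑)):
  -- it is closed under equality of regular open sets.
  IsBasicNbhdFrame : ∀ {ι n} {I : Set ι} → (I → Pt → RO → Set n) → Set (ι ⊔ n ⊔ a ⊔ r ⊔ suc L)
  IsBasicNbhdFrame {I = I} N =
      (∀ i x U V → U ≈RO V → N i x U → N i x V)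
    × (∀ i x x' → x' ⊑ x → ∀ U → N i x U → N i x' U)
    × (∀ i x U → ¬ N i x U → ∃[ x' ] (x' ⊑ x × (∀ x'' → x'' ⊑ x' → ¬ N i x'' U)))

  Box : ∀ {n} → (Pt → RO → Set n) → RO → (Pt → Set n)
  Box N U x = N x U

-- Every operator φ on RO(S, ⊑) that respects equality is the box of the
-- neighbourhood function N(x) := {U | x ∈ φ U}: persistence holds because
-- regular open sets are downward closed, and refinability is (classically)
-- regularity of φ U itself.  The operations f_i of an expansion of B are
-- transported along the isomorphism h : B ≅ RO(S, ⊑) to such operators
-- φ_i U := h (f_i (h⁻¹ U)), and h then becomes an isomorphism of expansions.
module Submission where

open import Defs
open import Level using (Level; _⊔_; Lift; lift; lower)
open import Data.Product using (Σ; ∃-syntax; _×_; _,_; proj₁; proj₂)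
open import Relation.Binary.Bundles using (Poset)
open import Algebra.Lattice.Bundles using (BooleanAlgebra)
open import Axiom.ExcludedMiddle using (ExcludedMiddle)
open import Relation.Nullary using (¬_)
open import Relation.Nullary.Decidable using (map′; decidable-stable)

module RegularOpen {a e r} (S : Poset a e r) (p : Level) where
  open Poset S using () renaming (_≤_ to _⊑_)
  open RO S p

  ≈RO-sym : ∀ {U V} → U ≈RO V → V ≈RO U
  ≈RO-sym U≈V x = proj₂ (U≈V x) , proj₁ (U≈V x)

  ≈RO-trans : ∀ {U V W} → U ≈RO V → V ≈RO W → U ≈RO W
  ≈RO-trans U≈V V≈W x =
    (λ u → proj₁ (V≈W x) (proj₁ (U≈V x) u)) , (λ w → proj₂ (U≈V x) (proj₂ (V≈W x) w))

  refine-outside : ∀ {q} → ExcludedMiddle (L ⊔ q) → (U : RO) → ∀ {x} → ¬ ⟦ U ⟧ x →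
                   ∃[ x' ] (x' ⊑ x × (∀ x'' → x'' ⊑ x' → ¬ ⟦ U ⟧ x''))
  refine-outside {q} em U {x} x∉U = stable λ ¬refinement →
    x∉U (proj₂ (proj₂ U x) λ x' x'⊑x → stable λ ¬meets →
      ¬refinement (x' , x'⊑x , λ x'' x''⊑x' u → ¬meets (x'' , x''⊑x' , u)))
    where
    stable : {P : Set L} → ¬ ¬ P → P
    stable = decidable-stable (map′ lower lift (em {Lift q _}))

module OperatorFrame {a e r} (S : Poset a e r) (p : Level) where
  open Poset S using () renaming (Carrier to Pt)
  open RO S p
  open Frame S p
  open RegularOpen S p

  nbhd : ∀ {ι} q {I : Set ι} → (I → RO → RO) → I → Pt → RO → Set (L ⊔ q)
  nbhd q φ i x U = Lift q (⟦ φ i U ⟧ x)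

  nbhd-isBasicNbhdFrame : ∀ {ι q} {I : Set ι} → ExcludedMiddle (L ⊔ q) →
                          (φ : I → RO → RO) → (∀ i {U V} → U ≈RO V → φ i U ≈RO φ i V) →
                          IsBasicNbhdFrame (nbhd q φ)
  nbhd-isBasicNbhdFrame {q = q} em φ φ-cong =
      (λ i x U V U≈V (lift u) → lift (proj₁ (φ-cong i U≈V x) u))
    , (λ i x x' x'⊑x U (lift u) → lift (persist (φ i U) x'⊑x u))
    , λ i x U x∉ →
        let (x' , x'⊑x , outside) = refine-outside {q = q} em (φ i U) (λ u → x∉ (lift u))
        in x' , x'⊑x , λ x'' x''⊑x' (lift u) → outside x'' x''⊑x' u

module Transport {c ℓ a e r} (B : BooleanAlgebra c ℓ) (S : Poset a e r) (p : Level)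
  (h : BooleanAlgebra.Carrier B → RO.RO S p) (h-iso : Iso.IsBooleanIso B S p h) where
  open BooleanAlgebra B using (Carrier; _≈_)
  open RO S p
  open RegularOpen S p

  h-cong : ∀ {x y} → x ≈ y → h x ≈RO h y
  h-cong = proj₁ h-iso

  h-injective : ∀ {x y} → h x ≈RO h y → x ≈ y
  h-injective = proj₁ (proj₂ h-iso)

  h⁻¹ : RO → Carrier
  h⁻¹ U = proj₁ (proj₁ (proj₂ (proj₂ h-iso)) U)

  h-h⁻¹ : ∀ U → h (h⁻¹ U) ≈RO U
  h-h⁻¹ U = proj₂ (proj₁ (proj₂ (proj₂ h-iso)) U)

  h⁻¹-cong : ∀ {U V} → U ≈RO V → h⁻¹ U ≈ h⁻¹ V
  h⁻¹-cong {U} {V} U≈V =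
    h-injective (≈RO-trans {h (h⁻¹ U)} {U} {h (h⁻¹ V)} (h-h⁻¹ U)
                  (≈RO-trans {U} {V} {h (h⁻¹ V)} U≈V (≈RO-sym {h (h⁻¹ V)} {V} (h-h⁻¹ V))))

  h⁻¹-h : ∀ x → h⁻¹ (h x) ≈ x
  h⁻¹-h x = h-injective (h-h⁻¹ (h x))

  conjugate : (Carrier → Carrier) → RO → RO
  conjugate g U = h (g (h⁻¹ U))

  conjugate-cong : ∀ {g} → (∀ {x y} → x ≈ y → g x ≈ g y) →
                   ∀ {U V} → U ≈RO V → conjugate g U ≈RO conjugate g V
  conjugate-cong g-cong U≈V = h-cong (g-cong (h⁻¹-cong U≈V))

  h-conjugate : ∀ {g} → (∀ {x y} → x ≈ y → g x ≈ g y) →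
                ∀ x → h (g x) ≈RO conjugate g (h x)
  h-conjugate g-cong x = h-cong (g-cong (BooleanAlgebra.sym B (h⁻¹-h x)))

proposition5p2p10 :
    ∀ {c ℓ a e r ι} (p : Level) →
    ExcludedMiddle (c ⊔ ℓ ⊔ a ⊔ r ⊔ p) →
    (B : BooleanAlgebra c ℓ) → BA.IsComplete B →
    (S : Poset a e r) →
    (∃[ h ] Iso.IsBooleanIso B S p h) →
    (I : Set ι) (f : I → BooleanAlgebra.Carrier B → BooleanAlgebra.Carrier B) →
    (∀ i {x y} → BooleanAlgebra._≈_ B x y → BooleanAlgebra._≈_ B (f i x) (f i y)) →
    Σ (I → Poset.Carrier S → RO.RO S p → Set (c ⊔ ℓ ⊔ a ⊔ r ⊔ p)) λ N →
      Frame.IsBasicNbhdFrame S p N ×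
      ∃[ g ] (Iso.IsBooleanIso B S p g ×
              (∀ i x → RO._≐_ S p (RO.⟦_⟧ S p (g (f i x))) (Frame.Box S p (N i) (g x))))
proposition5p2p10 {c} {ℓ} p em B _ S (h , h-iso) I f f-cong =
    nbhd (c ⊔ ℓ) φ
  , nbhd-isBasicNbhdFrame em φ (λ i → conjugate-cong (f-cong i))
  , h , h-iso , box
  where
  open OperatorFrame S p
  open Transport B S p h h-iso

  φ : I → RO.RO S p → RO.RO S p
  φ i = conjugate (f i)

  box : ∀ i x → RO._≐_ S p (RO.⟦_⟧ S p (h (f i x))) (Frame.Box S p (nbhd (c ⊔ ℓ) φ i) (h x))
  box i x y = let fx≈φhx = h-conjugate (f-cong i) x y
              in (λ u → lift (proj₁ fx≈φhx u)) , λ (lift u) → proj₂ fx≈φhx u
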